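{- Let $T$ be a string, $\Delta$ a positive integer, and $b_1b_2\cdots b_z$ a $\Delta$-approximate LZ factorisation of $T$. For every square $T[s..s+2\ell-1]$ of length $2\ell\ge 8\Delta$ there is at least one phrase $b_i$ with $|\mathrm{tail}(b_i)|\ge \frac{\ell}{4}\ge\Delta$ such that the fragment $\mathrm{tail}(b_i)$ and the fragment $T[s+\ell..s+2\ell-1]$ share at least one position.
   Context: A square is a fragment $T[s..s+2\ell-1]$ with $T[s..s+\ell-1]=T[s+\ell..s+2\ell-1]$. For a string $T[1..N]$: the (standard) LZ phrase starting at position $s$ is the unique fragment $T[s..e']$ such that $T[s..e'-1]$ occurs at least twice in $T[1..e'-1]$ and either $e'=N$ or $T[s..e']$ occurs only once in $T[1..e']$. A fragment $T[s..e]$ is a $\Delta$-approximate LZ phrase if it can be split as $T[s..e]=\mathrm{head}\cdot\mathrm{tail}$ with $|\mathrm{head}|<\Delta$ such that (i) the tail is empty or occurs at least twice in $T[1..e]$, and (ii) the LZ phrase $T[s..e']$ starting at $s$ satisfies $e'-1\le e$. A $\Delta$-approximate LZ factorisation is $T=b_1\cdots b_z$ where each $b_i$ is a $\Delta$-approximate LZ phrase $T[s..e]$ with $s=1+\sum_{j<i}|b_j|$, $e=\sum_{j\le i}|b_j|$, with a fixed head/tail split $b_i=\mathrm{head}(b_i)\mathrm{tail}(b_i)$. -}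

module Defs where

open import Data.Nat using (ℕ; zero; suc; _+_; _*_; _∸_; _≤_; _<_)
open import Data.Product using (Σ; ∃; _×_; _,_)
open import Data.Sum using (_⊎_)
open import Data.List using (List; []; _∷_)
open import Relation.Binary.PropositionalEquality using (_≡_; _≢_)

-- A string T[1..N] over an alphabet A is given by its length N and a
-- function T : ℕ → A; only the positions 1..N are ever inspected.
-- A fragment is described by its start position i and its length len,
-- i.e. T[i..i+len-1] (len = 0 is the empty fragment).

OccAt : {A : Set} → (ℕ → A) → (i len e p : ℕ) → Set
OccAt T i len e p =
  (1 ≤ p) × (p + len ≤ suc e) × (∀ k → k < len → T (p + k) ≡ T (i + k))

-- Convention: the empty fragment counts as occurring at least twice
-- (it is the empty tail / the empty prefix of a length-1 LZ phrase).
OccTwice : {A : Set} → (ℕ → A) → (i len e : ℕ) → Set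
OccTwice T i len e =
  (len ≡ 0) ⊎ (∃ λ p → ∃ λ q → (p ≢ q) × OccAt T i len e p × OccAt T i len e q)

OccOnce : {A : Set} → (ℕ → A) → (i len e : ℕ) → Set
OccOnce T i len e = OccAt T i len e i × (∀ p → OccAt T i len e p → p ≡ i)

-- T[s..e'] is the (standard) LZ phrase starting at s, for T of length N:
-- T[s..e'-1] occurs at least twice in T[1..e'-1] and
-- either e' = N or T[s..e'] occurs only once in T[1..e'].
IsLZPhrase : {A : Set} → (ℕ → A) → (N s e' : ℕ) → Set
IsLZPhrase T N s e' =
  (s ≤ e') × (e' ≤ N) ×
  OccTwice T s (e' ∸ s) (e' ∸ 1) ×
  ((e' ≡ N) ⊎ OccOnce T s (suc (e' ∸ s)) e')

-- T[s..e] with e = s + h + t - 1, split as head = T[s..s+h-1] and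
-- tail = T[s+h..e], is a Δ-approximate LZ phrase (with this split).
IsApproxPhrase : {A : Set} → (ℕ → A) → (N Δ s h t : ℕ) → Set
IsApproxPhrase T N Δ s h t =
  (h < Δ) ×
  OccTwice T (s + h) t (s + h + t ∸ 1) ×
  (∃ λ e' → IsLZPhrase T N s e' × (e' ∸ 1 ≤ s + h + t ∸ 1))

-- A factorisation is a list of phrases, each given by the pair
-- (|head(b_i)|, |tail(b_i)|).
IsApproxFactFrom : {A : Set} → (ℕ → A) → (N Δ s : ℕ) → List (ℕ × ℕ) → Set
IsApproxFactFrom T N Δ s [] = s ≡ suc N
IsApproxFactFrom T N Δ s ((h , t) ∷ bs) =
  IsApproxPhrase T N Δ s h t × IsApproxFactFrom T N Δ (s + h + t) bs

IsApproxFact : {A : Set} → (ℕ → A) → (N Δ : ℕ) → List (ℕ × ℕ) → Set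
IsApproxFact T N Δ bs = IsApproxFactFrom T N Δ 1 bs

phrasesFrom : ℕ → List (ℕ × ℕ) → List (ℕ × ℕ × ℕ)
phrasesFrom s [] = []
phrasesFrom s ((h , t) ∷ bs) = (s , h , t) ∷ phrasesFrom (s + h + t) bs

phrases : List (ℕ × ℕ) → List (ℕ × ℕ × ℕ)
phrases bs = phrasesFrom 1 bs

IsSquare : {A : Set} → (ℕ → A) → (N s ℓ : ℕ) → Set
IsSquare T N s ℓ =
  (1 ≤ s) × (s + 2 * ℓ ≤ suc N) × (∀ k → k < ℓ → T (s + k) ≡ T (s + ℓ + k))

{-# OPTIONS --safe #-}
-- Let b be the phrase containing s + ℓ, the first position of the second half.  If
-- |b| ≥ ℓ/2, its tail misses fewer than Δ ≤ ℓ/4 of its positions, so it is long and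
-- starts inside the second half.  Otherwise the next phrase starts at some E in the
-- first half of the second half.  T[E..s+2ℓ-1] also occurs ℓ positions earlier, so the
-- LZ phrase at E, and hence the approximate phrase at E, reaches the end of the square;
-- as its head is shorter than Δ, its tail is long.
module Submission where

open import Defs
open import Data.Nat using (ℕ; zero; suc; _+_; _*_; _∸_; _⊔_; _≤_; _<_; z≤n; s≤s; _≤?_; _<?_)
open import Data.Nat.Properties
open import Data.Nat.Tactic.RingSolver using (solve-∀; solve)
open import Data.Product using (∃; _×_; _,_; proj₁; proj₂)
open import Data.Sum using (inj₁; inj₂)
open import Data.List using (List; []; _∷_)
open import Data.List.Membership.Propositional using (_∈_)
open import Data.List.Relation.Unary.Any using (here; there)
open import Data.List.Relation.Binary.Subset.Propositional using (_⊆_)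
open import Data.Empty using (⊥-elim)
open import Function using (_∘_)
open import Relation.Nullary using (yes; no)
open import Relation.Binary.PropositionalEquality

Overlap : (a b c d : ℕ) → Set
Overlap a b c d = ∃ λ p → (a ≤ p) × (p < b) × (c ≤ p) × (p < d)

intervals-overlap : ∀ {a b c d} → a < b → c < d → a < d → c < b → Overlap a b c d
intervals-overlap {a} {c = c} a<b c<d a<d c<b =
  a ⊔ c , m≤m⊔n a c , ⊔-lub a<b c<b , m≤n⊔m a c , ⊔-lub a<d c<d

m∸1≤n∸1⇒m≤n : ∀ {m n} → 1 ≤ n → m ∸ 1 ≤ n ∸ 1 → m ≤ n
m∸1≤n∸1⇒m≤n {zero}           _ _  = z≤n
m∸1≤n∸1⇒m≤n {suc _} {suc _}  _ le = s≤s le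

m+2*n≡m+n+n : ∀ m n → m + 2 * n ≡ m + n + n
m+2*n≡m+n+n = solve-∀

tail-bound : ∀ {Δ ℓ h t} → h < Δ → 4 * Δ ≤ ℓ → ℓ ≤ 2 * suc (h + t) → ℓ ≤ 4 * t
tail-bound {Δ} {ℓ} {h} {t} h<Δ 4Δ≤ℓ ℓ≤2[1+h+t] = +-cancelˡ-≤ ℓ ℓ (4 * t) (begin
  ℓ + ℓ                 ≡⟨ solve (ℓ ∷ []) ⟩
  2 * ℓ                 ≤⟨ *-monoʳ-≤ 2 ℓ≤2[1+h+t] ⟩
  2 * (2 * suc (h + t)) ≡⟨ solve (h ∷ t ∷ []) ⟩
  4 * suc h + 4 * t     ≤⟨ +-monoˡ-≤ (4 * t) (*-monoʳ-≤ 4 h<Δ) ⟩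
  4 * Δ + 4 * t         ≤⟨ +-monoˡ-≤ (4 * t) 4Δ≤ℓ ⟩
  ℓ + 4 * t             ∎)
  where open ≤-Reasoning

tail-nonempty : ∀ {ℓ t} → 1 ≤ ℓ → ℓ ≤ 4 * t → 1 ≤ t
tail-nonempty {t = zero}  1≤ℓ ℓ≤0 = ≤-trans 1≤ℓ ℓ≤0
tail-nonempty {t = suc _} _   _   = s≤s z≤n

module _ {s ℓ E L : ℕ} (E≤s+ℓ+L : E ≤ s + ℓ + L) (2[1+L]<ℓ : 2 * suc L < ℓ) where

  2[1+L]≤ℓ : 2 * suc L ≤ ℓ
  2[1+L]≤ℓ = <⇒≤ 2[1+L]<ℓ

  end<s+2ℓ : E < s + 2 * ℓ
  end<s+2ℓ = begin-strict
    E          ≤⟨ E≤s+ℓ+L ⟩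
    s + ℓ + L  <⟨ +-monoʳ-< (s + ℓ) (≤-trans (m≤m+n (suc L) _) 2[1+L]≤ℓ) ⟩
    s + ℓ + ℓ  ≡⟨ m+2*n≡m+n+n s ℓ ⟨
    s + 2 * ℓ  ∎
    where open ≤-Reasoning

  end+head<s+2ℓ : ∀ {h} → 2 * h < ℓ → E + h < s + 2 * ℓ
  end+head<s+2ℓ {h} 2h<ℓ = *-cancelˡ-≤ 2 (begin
    2 * suc (E + h)                   ≤⟨ *-monoʳ-≤ 2 (s≤s (+-monoˡ-≤ h E≤s+ℓ+L)) ⟩
    2 * suc (s + ℓ + L + h)           ≡⟨ solve (s ∷ ℓ ∷ L ∷ h ∷ []) ⟩
    2 * (s + ℓ) + 2 * suc L + 2 * h   ≤⟨ +-mono-≤ (+-monoʳ-≤ (2 * (s + ℓ)) 2[1+L]≤ℓ) (<⇒≤ 2h<ℓ) ⟩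
    2 * (s + ℓ) + ℓ + ℓ               ≡⟨ solve (s ∷ ℓ ∷ []) ⟩
    2 * (s + 2 * ℓ)                   ∎)
    where open ≤-Reasoning

  reaches-s+2ℓ⇒ℓ≤2[1+h+t] : ∀ {h t} → s + 2 * ℓ ≤ suc (E + h + t) → ℓ ≤ 2 * suc (h + t)
  reaches-s+2ℓ⇒ℓ≤2[1+h+t] {h} {t} reaches = ≤-trans ℓ≤2[h+t] (*-monoʳ-≤ 2 (n≤1+n (h + t)))
    where
    open ≤-Reasoning
    ℓ≤2[h+t] : ℓ ≤ 2 * (h + t)
    ℓ≤2[h+t] = +-cancelˡ-≤ (2 * (s + ℓ) + ℓ) ℓ (2 * (h + t)) (begin
      2 * (s + ℓ) + ℓ + ℓ                     ≡⟨ solve (s ∷ ℓ ∷ []) ⟩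
      2 * (s + 2 * ℓ)                         ≤⟨ *-monoʳ-≤ 2 reaches ⟩
      2 * suc (E + h + t)                     ≤⟨ *-monoʳ-≤ 2 (s≤s (+-monoˡ-≤ t (+-monoˡ-≤ h E≤s+ℓ+L))) ⟩
      2 * suc (s + ℓ + L + h + t)             ≡⟨ solve (s ∷ ℓ ∷ L ∷ h ∷ t ∷ []) ⟩
      2 * (s + ℓ) + 2 * suc L + 2 * (h + t)   ≤⟨ +-monoˡ-≤ (2 * (h + t)) (+-monoʳ-≤ (2 * (s + ℓ)) 2[1+L]≤ℓ) ⟩
      2 * (s + ℓ) + ℓ + 2 * (h + t)           ∎)

module _ {A : Set} (T : ℕ → A) (N : ℕ) where

  lzPhrase-covers-earlier-copy : ∀ {p e q m} → IsLZPhrase T N p e →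
    1 ≤ q → q < p → p + m ≤ suc N → (∀ k → k < m → T (q + k) ≡ T (p + k)) →
    p + m ≤ suc e
  lzPhrase-covers-earlier-copy (_ , _ , _ , inj₁ refl) _ _ fits _ = fits
  lzPhrase-covers-earlier-copy {p} {e} {q} {m} (p≤e , _ , _ , inj₂ (_ , unique)) 1≤q q<p _ copy
    with p + m ≤? suc e
  ... | yes reached = reached
  ... | no short =
    ⊥-elim (<⇒≢ q<p (unique q (1≤q , copy-fits , λ k k<len → copy k (<-trans k<len len<m))))
    where
    phrase-end : p + suc (e ∸ p) ≡ suc e
    phrase-end = trans (+-suc p (e ∸ p)) (cong suc (m+[n∸m]≡n p≤e))
    copy-fits : q + suc (e ∸ p) ≤ suc e
    copy-fits = ≤-trans (+-monoˡ-≤ (suc (e ∸ p)) (<⇒≤ q<p)) (≤-reflexive phrase-end)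
    len<m : suc (e ∸ p) < m
    len<m = +-cancelˡ-< p (suc (e ∸ p)) m (subst (_< p + m) (sym phrase-end) (≰⇒> short))

  lzPhrase-in-square-reaches-end : ∀ {s ℓ p e} → IsSquare T N s ℓ → 1 ≤ ℓ →
    s + ℓ ≤ p → p ≤ s + 2 * ℓ → IsLZPhrase T N p e → s + 2 * ℓ ≤ suc e
  lzPhrase-in-square-reaches-end {s} {ℓ} {e = e}
    (1≤s , square-fits , halves-agree) 1≤ℓ s+ℓ≤p p≤end lz
    with m≤n⇒∃[o]m+o≡n s+ℓ≤p
  ... | d , refl = subst (_≤ suc e) second-half-end
        (lzPhrase-covers-earlier-copy {m = ℓ ∸ d} lz
          (≤-trans 1≤s (m≤m+n s d)) (+-monoˡ-< d (m<m+n s 1≤ℓ))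
          (subst (_≤ suc N) (sym second-half-end) square-fits) copy)
    where
    d≤ℓ : d ≤ ℓ
    d≤ℓ = +-cancelˡ-≤ (s + ℓ) d ℓ (≤-trans p≤end (≤-reflexive (m+2*n≡m+n+n s ℓ)))
    second-half-end : s + ℓ + d + (ℓ ∸ d) ≡ s + 2 * ℓ
    second-half-end = begin
      s + ℓ + d + (ℓ ∸ d)   ≡⟨ +-assoc (s + ℓ) d (ℓ ∸ d) ⟩
      s + ℓ + (d + (ℓ ∸ d)) ≡⟨ cong (s + ℓ +_) (m+[n∸m]≡n d≤ℓ) ⟩
      s + ℓ + ℓ             ≡⟨ m+2*n≡m+n+n s ℓ ⟨
      s + 2 * ℓ             ∎
      where open ≡-Reasoning
    copy : ∀ k → k < ℓ ∸ d → T (s + d + k) ≡ T (s + ℓ + d + k)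
    copy k k<ℓ∸d = begin
      T (s + d + k)       ≡⟨ cong T (+-assoc s d k) ⟩
      T (s + (d + k))     ≡⟨ halves-agree (d + k) d+k<ℓ ⟩
      T (s + ℓ + (d + k)) ≡⟨ cong T (+-assoc (s + ℓ) d k) ⟨
      T (s + ℓ + d + k)   ∎
      where
      open ≡-Reasoning
      d+k<ℓ : d + k < ℓ
      d+k<ℓ = subst (d + k <_) (m+[n∸m]≡n d≤ℓ) (+-monoʳ-< d k<ℓ∸d)

  approxPhrase-in-square-reaches-end : ∀ {Δ s ℓ p h t} → IsSquare T N s ℓ → 1 ≤ ℓ →
    s + ℓ ≤ p → p ≤ s + 2 * ℓ → IsApproxPhrase T N Δ p h t → s + 2 * ℓ ≤ suc (p + h + t)
  approxPhrase-in-square-reaches-end {s = s} {ℓ} {p} {h} {t}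
    square@(1≤s , _) 1≤ℓ s+ℓ≤p p≤end (_ , _ , _ , lz , lz-end∸1≤end∸1) =
    ≤-trans (lzPhrase-in-square-reaches-end square 1≤ℓ s+ℓ≤p p≤end lz)
            (s≤s (m∸1≤n∸1⇒m≤n 1≤end lz-end∸1≤end∸1))
    where
    open ≤-Reasoning
    1≤end : 1 ≤ p + h + t
    1≤end = begin
      1          ≤⟨ 1≤s ⟩
      s          ≤⟨ m≤m+n s ℓ ⟩
      s + ℓ      ≤⟨ s+ℓ≤p ⟩
      p          ≤⟨ m≤m+n p h ⟩
      p + h      ≤⟨ m≤m+n (p + h) t ⟩
      p + h + t  ∎

  phrase-containing : ∀ {Δ s₀ x} bs → IsApproxFactFrom T N Δ s₀ bs → s₀ ≤ x → x ≤ N →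
    ∃ λ si → ∃ λ h → ∃ λ t → ∃ λ rest →
      IsApproxFactFrom T N Δ si ((h , t) ∷ rest) ×
      (phrasesFrom si ((h , t) ∷ rest) ⊆ phrasesFrom s₀ bs) ×
      (si ≤ x) × (x < si + h + t)
  phrase-containing [] refl N<x x≤N = ⊥-elim (1+n≰n (≤-trans N<x x≤N))
  phrase-containing {s₀ = s₀} {x} ((h , t) ∷ bs) fact s₀≤x x≤N with x <? s₀ + h + t
  ... | yes inside = s₀ , h , t , bs , fact , (λ m → m) , s₀≤x , inside
  ... | no beyond with phrase-containing bs (proj₂ fact) (≮⇒≥ beyond) x≤N
  ...   | si , h′ , t′ , rest , fact′ , suffix , si≤x , x<end =
          si , h′ , t′ , rest , fact′ , there ∘ suffix , si≤x , x<end

module _ {A : Set} (T : ℕ → A) (N Δ : ℕ) (1≤Δ : 1 ≤ Δ)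
         (bs : List (ℕ × ℕ)) (fact : IsApproxFact T N Δ bs)
         (s ℓ : ℕ) (square : IsSquare T N s ℓ) (4Δ≤ℓ : 4 * Δ ≤ ℓ) where

  LongTailInSecondHalf : Set
  LongTailInSecondHalf = ∃ λ si → ∃ λ h → ∃ λ t → ((si , h , t) ∈ phrases bs) ×
    (ℓ ≤ 4 * t) × (4 * Δ ≤ ℓ) × Overlap (si + h) (si + h + t) (s + ℓ) (s + 2 * ℓ)

  1≤ℓ : 1 ≤ ℓ
  1≤ℓ = ≤-trans 1≤Δ (≤-trans (m≤n*m Δ 4) 4Δ≤ℓ)

  2*head<ℓ : ∀ {h} → h < Δ → 2 * h < ℓ
  2*head<ℓ h<Δ = <-≤-trans (*-monoʳ-< 2 h<Δ) (≤-trans (*-monoˡ-≤ Δ (s≤s (s≤s (z≤n {2})))) 4Δ≤ℓ)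

  s+ℓ<s+2ℓ : s + ℓ < s + 2 * ℓ
  s+ℓ<s+2ℓ = subst (s + ℓ <_) (sym (m+2*n≡m+n+n s ℓ)) (m<m+n (s + ℓ) 1≤ℓ)

  1≤s+ℓ : 1 ≤ s + ℓ
  1≤s+ℓ = ≤-trans (proj₁ square) (m≤m+n s ℓ)

  s+ℓ≤N : s + ℓ ≤ N
  s+ℓ≤N = ≤-pred (<-≤-trans s+ℓ<s+2ℓ (proj₁ (proj₂ square)))

  start+head<s+2ℓ : ∀ {si h} → si ≤ s + ℓ → h < Δ → si + h < s + 2 * ℓ
  start+head<s+2ℓ {si} {h} si≤s+ℓ h<Δ =
    subst (si + h <_) (sym (m+2*n≡m+n+n s ℓ))
      (+-mono-≤-< si≤s+ℓ (≤-<-trans (m≤m+n h _) (2*head<ℓ h<Δ)))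

  end≤s+ℓ+length : ∀ {si h t} → si ≤ s + ℓ → si + h + t ≤ s + ℓ + (h + t)
  end≤s+ℓ+length {si} {h} {t} si≤s+ℓ =
    ≤-trans (≤-reflexive (+-assoc si h t)) (+-monoˡ-≤ (h + t) si≤s+ℓ)

  long-tail-in-second-half : ∀ {si h t} → (si , h , t) ∈ phrases bs → h < Δ →
    ℓ ≤ 2 * suc (h + t) → si + h < s + 2 * ℓ → s + ℓ < si + h + t → LongTailInSecondHalf
  long-tail-in-second-half {si} {h} {t} phrase h<Δ long tail-start<s+2ℓ s+ℓ<end =
    si , h , t , phrase , ℓ≤4t , 4Δ≤ℓ ,
    intervals-overlap (m<m+n (si + h) (tail-nonempty 1≤ℓ ℓ≤4t)) s+ℓ<s+2ℓ tail-start<s+2ℓ s+ℓ<end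
    where
    ℓ≤4t : ℓ ≤ 4 * t
    ℓ≤4t = tail-bound h<Δ 4Δ≤ℓ long

  next-phrase-has-long-tail : ∀ {E L} rest → IsApproxFactFrom T N Δ E rest →
    phrasesFrom E rest ⊆ phrases bs → s + ℓ < E → E ≤ s + ℓ + L → 2 * suc L < ℓ →
    LongTailInSecondHalf
  next-phrase-has-long-tail [] E≡1+N _ _ E≤ short =
    ⊥-elim (<-irrefl E≡1+N (<-≤-trans (end<s+2ℓ E≤ short) (proj₁ (proj₂ square))))
  next-phrase-has-long-tail {E} ((h , t) ∷ _) (phrase@(h<Δ , _) , _) next⊆ s+ℓ<E E≤ short =
    long-tail-in-second-half (next⊆ (here refl)) h<Δ
      (reaches-s+2ℓ⇒ℓ≤2[1+h+t] E≤ short reaches)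
      (end+head<s+2ℓ E≤ short (2*head<ℓ h<Δ))
      (<-≤-trans s+ℓ<E (≤-trans (m≤m+n E h) (m≤m+n (E + h) t)))
    where
    reaches : s + 2 * ℓ ≤ suc (E + h + t)
    reaches = approxPhrase-in-square-reaches-end T N square 1≤ℓ
      (<⇒≤ s+ℓ<E) (<⇒≤ (end<s+2ℓ E≤ short)) phrase

  square-meets-long-tail : LongTailInSecondHalf
  square-meets-long-tail with phrase-containing T N bs fact 1≤s+ℓ s+ℓ≤N
  ... | si , h , t , rest , ((h<Δ , _) , fact-rest) , phrase⊆ , si≤s+ℓ , s+ℓ<end
    with ℓ ≤? 2 * suc (h + t)
  ...   | yes long = long-tail-in-second-half (phrase⊆ (here refl)) h<Δ long
                       (start+head<s+2ℓ si≤s+ℓ h<Δ) s+ℓ<end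
  ...   | no short = next-phrase-has-long-tail rest fact-rest (phrase⊆ ∘ there) s+ℓ<end
                       (end≤s+ℓ+length si≤s+ℓ) (≰⇒> short)

lemma17 : {A : Set} (T : ℕ → A) (N Δ : ℕ) → 1 ≤ Δ →
    (bs : List (ℕ × ℕ)) → IsApproxFact T N Δ bs →
    (s ℓ : ℕ) → IsSquare T N s ℓ → 8 * Δ ≤ 2 * ℓ →
    ∃ λ si → ∃ λ h → ∃ λ t → ((si , h , t) ∈ phrases bs) ×
      (ℓ ≤ 4 * t) × (4 * Δ ≤ ℓ) ×
      (∃ λ p → (si + h ≤ p) × (p < si + h + t) × (s + ℓ ≤ p) × (p < s + 2 * ℓ))
lemma17 T N Δ 1≤Δ bs fact s ℓ square 8Δ≤2ℓ =
  square-meets-long-tail T N Δ 1≤Δ bs fact s ℓ square 4Δ≤ℓ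
  where
  4Δ≤ℓ : 4 * Δ ≤ ℓ
  4Δ≤ℓ = *-cancelˡ-≤ 2 (subst (_≤ 2 * ℓ) (*-assoc 2 4 Δ) 8Δ≤2ℓ)
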